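{- Let $K\ge 1$ and $N\ge 1$ be integers. Define tuples $R_0,R_1,\dots,R_N$, each consisting of $K+1$ finite lists $R_n=(L^{(n)}_0,L^{(n)}_1,\dots,L^{(n)}_K)$ whose entries are finite lists of natural numbers, as follows. $R_0$ has $L^{(0)}_0=[\,[\,]\,]$ (the list containing only the empty list) and $L^{(0)}_k=[\,]$ (the empty list) for $1\le k\le K$. For $1\le n\le N$, $R_n$ is obtained from $R_{n-1}$ by $$L^{(n)}_0=[\,[\,]\,],\qquad L^{(n)}_k \;=\; L^{(n-1)}_k \;+\!\!+\; \mathit{reverse}\big(\mathit{map}(\,\cdot +\!\!+ [n],\;L^{(n-1)}_{k-1})\big)\quad (1\le k\le K),$$ where $+\!\!+$ is list concatenation, $\mathit{map}(\,\cdot +\!\!+[n], L)$ appends the element $n$ to the end of every list in $L$ (preserving the order of $L$), and $\mathit{reverse}$ reverses the order of a list. Then for every $1\le k\le K$, the list $L^{(N)}_k$ contains every $k$-element subset of $\{1,\dots,N\}$ exactly once (each represented as a list of its elements), and it is in revolving door order: any two consecutive entries of $L^{(N)}_k$, regarded as sets, differ by exactly two elements (i.e. their symmetric difference has size $2$, so one is obtained from the other by removing one element and inserting another), and, if $L^{(N)}_k$ has at least two entries, its last entry and its first entry also differ by exactly two elements in this sense.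
   Context: This is the sequential "revolving door" recursion $\mathit{kcombs}(K,[N,N-1,\dots,1])=\mathit{for}_{\text{revol}}(N,\mathit{kcombs}(K,[N-1,\dots,1]))$ with $\mathit{kcombs}(K,[\,])=[[[\,]],[\,]^K]$ and $\mathit{for}_{\text{revol}}(x,(\mathit{cs}_0,\dots,\mathit{cs}_K))=[[[\,]]]\cup[\mathit{cs}_k\cup\mathit{reverse}(\mathit{map}(\cup[x],\mathit{cs}_{k-1}))\mid k\leftarrow[1,\dots,K]]$; the $k$-th entry (indexing from $0$) of the output is denoted $\mathit{cs}_k^N$. The revolving door property means that adjacent combinations, cyclically including the last and first, differ by exactly two elements. -}

module Defs where

open import Data.Nat using (ℕ; zero; suc; _≤_)
open import Data.List using (List; []; _∷_; _++_; [_]; map; reverse; length; lookup)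
open import Data.List.Membership.Propositional using (_∈_; _∉_)
open import Data.List.Relation.Unary.All using (All)
open import Data.List.Relation.Unary.Unique.Propositional using (Unique)
open import Data.Fin using (Fin)
open import Data.Product using (_×_; Σ; ∃; ∃-syntax)
open import Data.Sum using (_⊎_)
open import Relation.Binary.PropositionalEquality using (_≡_; _≢_)
open import Function.Bundles using (_⇔_)

-- The recursion for the
-- component k only uses components ≤ k, so the family does not depend on K;
-- K only bounds which components are considered.
L : ℕ → ℕ → List (List ℕ)
L zero    zero    = [ [] ]
L zero    (suc k) = []
L (suc n) zero    = [ [] ]
L (suc n) (suc k) = L n (suc k) ++ reverse (map (_++ [ suc n ]) (L n k))

IsKSubset : ℕ → ℕ → List ℕ → Set
IsKSubset N k xs = Unique xs × length xs ≡ k × All (λ x → 1 ≤ x × x ≤ N) xs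

SameSet : List ℕ → List ℕ → Set
SameSet xs ys = ∀ z → (z ∈ xs) ⇔ (z ∈ ys)

InSymDiff : List ℕ → List ℕ → ℕ → Set
InSymDiff xs ys z = (z ∈ xs × z ∉ ys) ⊎ (z ∈ ys × z ∉ xs)

DifferByTwo : List ℕ → List ℕ → Set
DifferByTwo xs ys =
  ∃[ a ] ∃[ b ] (a ≢ b × InSymDiff xs ys a × InSymDiff xs ys b
                 × (∀ z → InSymDiff xs ys z → z ≡ a ⊎ z ≡ b))

OccursExactlyOnce : List (List ℕ) → List ℕ → Set
OccursExactlyOnce cs ys =
  ∃[ i ] (SameSet (lookup cs i) ys × (∀ (j : Fin (length cs)) → SameSet (lookup cs j) ys → j ≡ i))

-- Splitting the k-subsets of {1,…,n} according as n is absent or present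
-- matches the two halves of L n k, which gives the exactly-once property by
-- induction.  Inside each half consecutive entries differ by one swap by
-- induction, since appending n to both sides and reversing a list preserve
-- this relation.  At the seam, and cyclically, one uses that L n k starts
-- with {1,…,k} and, for 1 ≤ k ≤ n, ends with {1,…,k-1,n}.
module Submission where

open import Defs
open import Data.Nat using (ℕ; zero; suc; _≤_; _<_; z≤n; s≤s; _≟_; _≤?_)
open import Data.Nat.Properties
open import Data.List using (List; []; _∷_; _++_; _∷ʳ_; [_]; map; reverse; length; head; last; lookup)
open import Data.List.Properties using (unfold-reverse; reverse-involutive; head-map; last-map; ++-assoc)
open import Data.List.Relation.Unary.All as All using (All; []; _∷_)
import Data.List.Relation.Unary.All.Properties as All
open import Data.List.Relation.Unary.Any using (here; there)
import Data.List.Relation.Unary.Any.Properties as Any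
open import Data.List.Relation.Unary.AllPairs using ([]; _∷_)
open import Data.List.Relation.Unary.Linked as Linked using (Linked; []; [-]; _∷_)
import Data.List.Relation.Unary.Linked.Properties as Linked
open import Data.List.Relation.Binary.Permutation.Propositional using (_↭_; ↭-refl; ↭-sym; ↭⇒↭ₛ; swap)
open import Data.List.Relation.Binary.Permutation.Propositional.Properties
  using (∈-resp-↭; All-resp-↭; ↭-length; ++⁺ˡ; shift; ∷↭∷ʳ)
import Data.List.Relation.Binary.Permutation.Setoid.Properties as Permutationₛ
open import Data.List.Membership.Propositional using (_∈_; _∉_)
open import Data.List.Membership.Propositional.Properties using (∈-++⁻; ∈-++⁺ʳ; ∈-∃++; ∈-lookup)
open import Data.List.Membership.DecPropositional _≟_ using (_∈?_)
open import Data.Maybe as Maybe using (just; nothing)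
open import Data.Maybe.Properties using (just-injective)
open import Data.Maybe.Relation.Binary.Connected as Connected using (Connected; just; nothing-just; nothing)
open import Data.Fin using (Fin; zero; suc)
open import Data.Product as Product using (_×_; _,_; proj₂; ∃)
open import Data.Sum as Sum using (_⊎_; inj₁; inj₂)
open import Data.Empty using (⊥-elim)
open import Function using (_∘_; _⇔_; mk⇔; Equivalence)
open import Relation.Nullary using (¬_; yes; no)
open import Relation.Binary.Definitions using (Symmetric; tri<; tri≈; tri>)
open import Relation.Binary.PropositionalEquality
  using (_≡_; _≢_; refl; sym; trans; cong; subst; subst₂; setoid; module ≡-Reasoning)

private
  variable
    A : Set
    a b n k : ℕ
    xs xs′ ys ys′ : List ℕ

head-++ : ∀ {x} {xs ys : List A} → head xs ≡ just x → head (xs ++ ys) ≡ just x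
head-++ {xs = _ ∷ _} eq = eq

last-++ : ∀ (xs : List A) {ys y} → last ys ≡ just y → last (xs ++ ys) ≡ just y
last-++ []               eq = eq
last-++ (x ∷ [])         {_ ∷ _} eq = eq
last-++ (x ∷ xs@(_ ∷ _)) eq = last-++ xs eq

last-reverse : (xs : List A) → last (reverse xs) ≡ head xs
last-reverse []       = refl
last-reverse (x ∷ xs) = trans (cong last (unfold-reverse x xs)) (last-++ (reverse xs) refl)

head-reverse : (xs : List A) → head (reverse xs) ≡ last xs
head-reverse xs = trans (sym (last-reverse (reverse xs))) (cong last (reverse-involutive xs))

All-reverse⁺ : ∀ {P : A → Set} {xs} → All P xs → All P (reverse xs)
All-reverse⁺ ps = All.tabulate (All.lookup ps ∘ Any.reverse⁻)

Linked-reverse⁺ : ∀ {R : A → A → Set} → Symmetric R → ∀ {xs} → Linked R xs → Linked R (reverse xs)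
Linked-reverse⁺ R-sym {[]}     []  = []
Linked-reverse⁺ {R = R} R-sym {x ∷ xs} Rxs rewrite unfold-reverse x xs =
  Linked.++⁺ (Linked-reverse⁺ R-sym (Linked.tail Rxs)) seam [-]
  where
  seam : Connected R (last (reverse xs)) (just x)
  seam rewrite last-reverse xs = Connected.sym R-sym (Linked.head′ Rxs)

Linked-map⁺ : ∀ {Q : A → Set} {R S : A → A → Set} {f : A → A} →
  (∀ {x y} → Q x → Q y → R x y → S (f x) (f y)) →
  ∀ {xs} → All Q xs → Linked R xs → Linked S (map f xs)
Linked-map⁺ F _               []          = []
Linked-map⁺ F _               [-]         = [-]
Linked-map⁺ F (qx ∷ qy ∷ qxs) (Rxy ∷ Rxs) = F qx qy Rxy ∷ Linked-map⁺ F (qy ∷ qxs) Rxs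

∈-∷ʳ : ∀ (xs : List ℕ) → a ∈ xs ∷ʳ a
∈-∷ʳ xs = ∈-++⁺ʳ xs (here refl)

∉-∷ʳ : a ∉ xs → a ≢ b → a ∉ xs ∷ʳ b
∉-∷ʳ {xs = xs} a∉xs a≢b a∈ with ∈-++⁻ xs a∈
... | inj₁ a∈xs      = a∉xs a∈xs
... | inj₂ (here eq) = a≢b eq

∈⇒↭∷ : a ∈ xs → ∃ λ xs′ → xs ↭ a ∷ xs′
∈⇒↭∷ a∈xs with as , bs , refl ← ∈-∃++ a∈xs = as ++ bs , shift _ as bs

∷ʳ-swap-↭ : ∀ (xs : List ℕ) a b → (xs ∷ʳ a) ∷ʳ b ↭ (xs ∷ʳ b) ∷ʳ a
∷ʳ-swap-↭ xs a b =
  subst₂ _↭_ (sym (++-assoc xs [ a ] [ b ])) (sym (++-assoc xs [ b ] [ a ]))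
    (++⁺ˡ xs (swap a b ↭-refl))

SameSet-refl : SameSet xs xs
SameSet-refl z = mk⇔ (λ p → p) (λ p → p)

SameSet-resp-↭ : xs ↭ xs′ → ys ↭ ys′ → SameSet xs ys → SameSet xs′ ys′
SameSet-resp-↭ xs↭ ys↭ same z = mk⇔
  (∈-resp-↭ ys↭ ∘ Equivalence.to (same z) ∘ ∈-resp-↭ (↭-sym xs↭))
  (∈-resp-↭ xs↭ ∘ Equivalence.from (same z) ∘ ∈-resp-↭ (↭-sym ys↭))

SameSet-∷ : a ∉ xs → a ∉ ys → SameSet xs ys ⇔ SameSet (a ∷ xs) (a ∷ ys)
SameSet-∷ {a} {xs} {ys} a∉xs a∉ys = mk⇔ cons uncons
  where
  cons : SameSet xs ys → SameSet (a ∷ xs) (a ∷ ys)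
  cons same z = mk⇔ (λ { (here eq) → here eq ; (there p) → there (Equivalence.to (same z) p) })
                    (λ { (here eq) → here eq ; (there p) → there (Equivalence.from (same z) p) })
  cancel : ∀ {us vs} → a ∉ us → ∀ {z} → z ∈ us → z ∈ a ∷ vs → z ∈ vs
  cancel a∉us z∈us (here refl) = ⊥-elim (a∉us z∈us)
  cancel a∉us z∈us (there z∈vs) = z∈vs
  uncons : SameSet (a ∷ xs) (a ∷ ys) → SameSet xs ys
  uncons same z = mk⇔ (λ p → cancel a∉xs p (Equivalence.to (same z) (there p)))
                      (λ p → cancel a∉ys p (Equivalence.from (same z) (there p)))

DifferByTwo-transport :
  (∀ {z} → InSymDiff xs ys z → InSymDiff xs′ ys′ z) →
  (∀ {z} → InSymDiff xs′ ys′ z → InSymDiff xs ys z) →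
  DifferByTwo xs ys → DifferByTwo xs′ ys′
DifferByTwo-transport to from (a , b , a≢b , a∈ , b∈ , only) =
  a , b , a≢b , to a∈ , to b∈ , λ z → only z ∘ from

DifferByTwo-sym : DifferByTwo xs ys → DifferByTwo ys xs
DifferByTwo-sym = DifferByTwo-transport Sum.swap Sum.swap

InSymDiff-resp-↭ : ∀ {z} → xs ↭ xs′ → ys ↭ ys′ → InSymDiff xs ys z → InSymDiff xs′ ys′ z
InSymDiff-resp-↭ xs↭ ys↭ = Sum.map
  (Product.map (∈-resp-↭ xs↭) (_∘ ∈-resp-↭ (↭-sym ys↭)))
  (Product.map (∈-resp-↭ ys↭) (_∘ ∈-resp-↭ (↭-sym xs↭)))

DifferByTwo-resp-↭ : xs ↭ xs′ → ys ↭ ys′ → DifferByTwo xs ys → DifferByTwo xs′ ys′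
DifferByTwo-resp-↭ xs↭ ys↭ =
  DifferByTwo-transport (InSymDiff-resp-↭ xs↭ ys↭) (InSymDiff-resp-↭ (↭-sym xs↭) (↭-sym ys↭))

DifferByTwo-∷ : a ∉ xs → a ∉ ys → DifferByTwo xs ys → DifferByTwo (a ∷ xs) (a ∷ ys)
DifferByTwo-∷ {a} a∉xs a∉ys = DifferByTwo-transport
  (Sum.map (onlyIn⁺ a∉xs) (onlyIn⁺ a∉ys)) (Sum.map onlyIn⁻ onlyIn⁻)
  where
  onlyIn⁺ : ∀ {us vs z} → a ∉ us → z ∈ us × z ∉ vs → z ∈ a ∷ us × z ∉ a ∷ vs
  onlyIn⁺ a∉us (z∈us , z∉vs) = there z∈us , λ { (here refl) → a∉us z∈us ; (there p) → z∉vs p }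
  onlyIn⁻ : ∀ {us vs z} → z ∈ a ∷ us × z ∉ a ∷ vs → z ∈ us × z ∉ vs
  onlyIn⁻ (here refl  , z∉) = ⊥-elim (z∉ (here refl))
  onlyIn⁻ (there z∈us , z∉) = z∈us , z∉ ∘ there

DifferByTwo-∷ʳ : a ∉ xs → a ∉ ys → DifferByTwo xs ys → DifferByTwo (xs ∷ʳ a) (ys ∷ʳ a)
DifferByTwo-∷ʳ {a} {xs} {ys} a∉xs a∉ys =
  DifferByTwo-resp-↭ (∷↭∷ʳ a xs) (∷↭∷ʳ a ys) ∘ DifferByTwo-∷ a∉xs a∉ys

DifferByTwo-swap : a ∉ xs → b ∉ xs → a ≢ b → DifferByTwo (a ∷ xs) (b ∷ xs)
DifferByTwo-swap {a} {xs} {b} a∉xs b∉xs a≢b =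
  a , b , a≢b , inj₁ (here refl , a∉bxs) , inj₂ (here refl , b∉axs) , only
  where
  a∉bxs : a ∉ b ∷ xs
  a∉bxs (here eq) = a≢b eq
  a∉bxs (there p) = a∉xs p
  b∉axs : b ∉ a ∷ xs
  b∉axs (here eq) = a≢b (sym eq)
  b∉axs (there p) = b∉xs p
  only : ∀ z → InSymDiff (a ∷ xs) (b ∷ xs) z → z ≡ a ⊎ z ≡ b
  only z (inj₁ (here eq , _)) = inj₁ eq
  only z (inj₁ (there p , q)) = ⊥-elim (q (there p))
  only z (inj₂ (here eq , _)) = inj₂ eq
  only z (inj₂ (there p , q)) = ⊥-elim (q (there p))

DifferByTwo-∷ʳ-swap : a ∉ xs → b ∉ xs → a ≢ b → DifferByTwo (xs ∷ʳ a) (xs ∷ʳ b)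
DifferByTwo-∷ʳ-swap {a} {xs} {b} a∉xs b∉xs a≢b =
  DifferByTwo-resp-↭ (∷↭∷ʳ a xs) (∷↭∷ʳ b xs) (DifferByTwo-swap a∉xs b∉xs a≢b)

IsKSubset-∉ : IsKSubset n k xs → suc n ∉ xs
IsKSubset-∉ (_ , _ , bounds) p = 1+n≰n (proj₂ (All.lookup bounds p))

IsKSubset-weaken : IsKSubset n k xs → IsKSubset (suc n) k xs
IsKSubset-weaken (unique , len , bounds) =
  unique , len , All.map (Product.map₂ m≤n⇒m≤1+n) bounds

IsKSubset-strengthen : suc n ∉ xs → IsKSubset (suc n) k xs → IsKSubset n k xs
IsKSubset-strengthen n+1∉xs (unique , len , bounds) =
  unique , len , All.tabulate λ x∈xs →
    let (1≤x , x≤n+1) = All.lookup bounds x∈xs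
    in 1≤x , m<1+n⇒m≤n (≤∧≢⇒< x≤n+1 λ { refl → n+1∉xs x∈xs })

IsKSubset-resp-↭ : xs ↭ ys → IsKSubset n k xs → IsKSubset n k ys
IsKSubset-resp-↭ xs↭ys (unique , len , bounds) =
  Permutationₛ.Unique-resp-↭ (setoid ℕ) (↭⇒↭ₛ xs↭ys) unique ,
  trans (sym (↭-length xs↭ys)) len ,
  All-resp-↭ xs↭ys bounds

IsKSubset-∷ : IsKSubset n k xs ⇔ IsKSubset (suc n) (suc k) (suc n ∷ xs)
IsKSubset-∷ {n} {k} {xs} = mk⇔ cons uncons
  where
  cons : IsKSubset n k xs → IsKSubset (suc n) (suc k) (suc n ∷ xs)
  cons s with unique , len , bounds ← IsKSubset-weaken s =
    (All.tabulate (λ { p refl → IsKSubset-∉ s p }) ∷ unique) ,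
    cong suc len ,
    (s≤s z≤n , ≤-refl) ∷ bounds
  uncons : IsKSubset (suc n) (suc k) (suc n ∷ xs) → IsKSubset n k xs
  uncons (n+1≢xs ∷ unique , len , _ ∷ bounds) =
    IsKSubset-strengthen (λ p → All.lookup n+1≢xs p refl) (unique , suc-injective len , bounds)

no-nonempty-subsets-of-∅ : ¬ IsKSubset 0 (suc k) xs
no-nonempty-subsets-of-∅ {xs = _ ∷ _} (_ , _ , (1≤x , x≤0) ∷ _) = <⇒≱ 1≤x x≤0

data ExactlyOne {A : Set} (P : A → Set) : List A → Set where
  here  : ∀ {x xs} → P x → All (¬_ ∘ P) xs → ExactlyOne P (x ∷ xs)
  there : ∀ {x xs} → ¬ P x → ExactlyOne P xs → ExactlyOne P (x ∷ xs)

module _ {P : A → Set} where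

  ExactlyOne-++⁺ˡ : ∀ {xs ys} → ExactlyOne P xs → All (¬_ ∘ P) ys → ExactlyOne P (xs ++ ys)
  ExactlyOne-++⁺ˡ (here px ¬Pxs)   ¬Pys = here px (All.++⁺ ¬Pxs ¬Pys)
  ExactlyOne-++⁺ˡ (there ¬px one) ¬Pys = there ¬px (ExactlyOne-++⁺ˡ one ¬Pys)

  ExactlyOne-++⁺ʳ : ∀ {xs ys} → All (¬_ ∘ P) xs → ExactlyOne P ys → ExactlyOne P (xs ++ ys)
  ExactlyOne-++⁺ʳ []            one = one
  ExactlyOne-++⁺ʳ (¬px ∷ ¬Pxs) one = there ¬px (ExactlyOne-++⁺ʳ ¬Pxs one)

  ExactlyOne-reverse⁺ : ∀ {xs} → ExactlyOne P xs → ExactlyOne P (reverse xs)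
  ExactlyOne-reverse⁺ {x ∷ xs} (here px ¬Pxs) rewrite unfold-reverse x xs =
    ExactlyOne-++⁺ʳ (All-reverse⁺ ¬Pxs) (here px [])
  ExactlyOne-reverse⁺ {x ∷ xs} (there ¬px one) rewrite unfold-reverse x xs =
    ExactlyOne-++⁺ˡ (ExactlyOne-reverse⁺ one) (¬px ∷ [])

  ExactlyOne-map⁺ : ∀ {f : A → A} {xs} → ExactlyOne (P ∘ f) xs → ExactlyOne P (map f xs)
  ExactlyOne-map⁺ (here px ¬Pxs)   = here px (All.map⁺ ¬Pxs)
  ExactlyOne-map⁺ (there ¬px one) = there ¬px (ExactlyOne-map⁺ one)

  ExactlyOne⇒lookup : ∀ {xs} → ExactlyOne P xs →
    ∃ λ i → P (lookup xs i) × (∀ (j : Fin (length xs)) → P (lookup xs j) → j ≡ i)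
  ExactlyOne⇒lookup (here px ¬Pxs) =
    zero , px , λ { zero _ → refl ; (suc j) pj → ⊥-elim (All.lookup ¬Pxs (∈-lookup j) pj) }
  ExactlyOne⇒lookup (there ¬px one) with i , pi , unique ← ExactlyOne⇒lookup one =
    suc i , pi , λ { zero p0 → ⊥-elim (¬px p0) ; (suc j) pj → cong suc (unique j pj) }

ExactlyOne-resp : ∀ {P Q : A → Set} {xs} → All (λ x → P x ⇔ Q x) xs → ExactlyOne P xs → ExactlyOne Q xs
ExactlyOne-resp (px⇔qx ∷ ps) (here px ¬Pxs) =
  here (Equivalence.to px⇔qx px) (All.zipWith (λ (p⇔q , ¬p) → ¬p ∘ Equivalence.from p⇔q) (ps , ¬Pxs))
ExactlyOne-resp (px⇔qx ∷ ps) (there ¬px one) =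
  there (¬px ∘ Equivalence.from px⇔qx) (ExactlyOne-resp ps one)

oneTo : ℕ → List ℕ
oneTo zero    = []
oneTo (suc k) = oneTo k ∷ʳ suc k

oneTo-∉ : k < a → a ∉ oneTo k
oneTo-∉ {zero}  _   ()
oneTo-∉ {suc k} k<a = ∉-∷ʳ (oneTo-∉ (<-trans (n<1+n k) k<a)) (>⇒≢ k<a)

L-empty : n < k → L n k ≡ []
L-empty {zero}  {suc k} _           = refl
L-empty {suc n} {suc k} (s≤s n<k) rewrite L-empty {n} {suc k} (m≤n⇒m≤1+n n<k) | L-empty n<k = refl

L-diagonal : ∀ n → L n n ≡ [ oneTo n ]
L-diagonal zero    = refl
L-diagonal (suc n) rewrite L-empty {n} {suc n} ≤-refl | L-diagonal n = refl

L-head : k ≤ n → head (L n k) ≡ just (oneTo k)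
L-head {zero}  {zero}  _ = refl
L-head {zero}  {suc n} _ = refl
L-head {suc k} {suc n} (s≤s k≤n) with m≤n⇒m<n∨m≡n k≤n
... | inj₁ k<n  = head-++ (L-head k<n)
... | inj₂ refl = cong head (L-diagonal (suc k))

L-last : suc k ≤ n → last (L n (suc k)) ≡ just (oneTo k ∷ʳ n)
L-last {k} {suc n} (s≤s k≤n) = last-++ (L n (suc k)) (begin
  last (reverse (map (_∷ʳ suc n) (L n k)))  ≡⟨ last-reverse (map (_∷ʳ suc n) (L n k)) ⟩
  head (map (_∷ʳ suc n) (L n k))            ≡⟨ head-map (L n k) ⟩
  Maybe.map (_∷ʳ suc n) (head (L n k))      ≡⟨ cong (Maybe.map (_∷ʳ suc n)) (L-head k≤n) ⟩
  just (oneTo k ∷ʳ suc n)                   ∎)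
  where open ≡-Reasoning

L-last-zero : ∀ n → last (L n zero) ≡ just []
L-last-zero zero    = refl
L-last-zero (suc n) = refl

L-kSubsets : ∀ n k → All (IsKSubset n k) (L n k)
L-kSubsets zero    zero    = ([] , refl , []) ∷ []
L-kSubsets zero    (suc k) = []
L-kSubsets (suc n) zero    = ([] , refl , []) ∷ []
L-kSubsets (suc n) (suc k) = All.++⁺
  (All.map IsKSubset-weaken (L-kSubsets n (suc k)))
  (All-reverse⁺ (All.map⁺ (All.map extend (L-kSubsets n k))))
  where
  extend : ∀ {xs} → IsKSubset n k xs → IsKSubset (suc n) (suc k) (xs ∷ʳ suc n)
  extend {xs} = IsKSubset-resp-↭ (∷↭∷ʳ (suc n) xs) ∘ Equivalence.to IsKSubset-∷

L-seam : ∀ n k → Connected DifferByTwo (last (L n (suc k))) (head (reverse (map (_∷ʳ suc n) (L n k))))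
L-seam n k rewrite head-reverse (map (_∷ʳ suc n) (L n k)) | last-map (_∷ʳ suc n) (L n k)
  with suc k ≤? n
... | no k≮n rewrite L-empty (≰⇒> k≮n) = nothing-connected
  where
  nothing-connected : ∀ {y} → Connected DifferByTwo nothing y
  nothing-connected {just _}  = nothing-just
  nothing-connected {nothing} = nothing
L-seam n zero    | yes 0<n rewrite L-last 0<n | L-last-zero n =
  just (DifferByTwo-∷ʳ-swap {xs = []} (λ ()) (λ ()) (<⇒≢ (n<1+n n)))
L-seam n (suc k) | yes k+1<n rewrite L-last k+1<n | L-last (<⇒≤ k+1<n) =
  just (DifferByTwo-resp-↭ (∷ʳ-swap-↭ (oneTo k) n (suc k)) ↭-refl
    (DifferByTwo-∷ʳ-swap
      (∉-∷ʳ (oneTo-∉ ≤-refl) (<⇒≢ k+1<n))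
      (∉-∷ʳ (oneTo-∉ (m<n⇒m<1+n (<-trans (n<1+n k) k+1<n))) 1+n≢n)
      (<⇒≢ (m<n⇒m<1+n k+1<n))))

L-revolvingDoor : ∀ n k → Linked DifferByTwo (L n k)
L-revolvingDoor zero    zero    = [-]
L-revolvingDoor zero    (suc k) = []
L-revolvingDoor (suc n) zero    = [-]
L-revolvingDoor (suc n) (suc k) =
  Linked.++⁺ (L-revolvingDoor n (suc k)) (L-seam n k)
    (Linked-reverse⁺ DifferByTwo-sym
      (Linked-map⁺ (λ sx sy → DifferByTwo-∷ʳ (IsKSubset-∉ sx) (IsKSubset-∉ sy))
        (L-kSubsets n k) (L-revolvingDoor n k)))

L-cyclic : ∀ n k → 2 ≤ length (L n k) → ∀ xs ys → last (L n k) ≡ just xs → head (L n k) ≡ just ys →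
  DifferByTwo xs ys
L-cyclic zero    zero    (s≤s ())
L-cyclic (suc n) zero    (s≤s ())
L-cyclic n (suc k) 2≤len xs ys last≡ head≡ with <-cmp (suc k) n
... | tri< k<n _ _ = subst₂ DifferByTwo
  (just-injective (trans (sym (L-last (<⇒≤ k<n))) last≡))
  (just-injective (trans (sym (L-head (<⇒≤ k<n))) head≡))
  (DifferByTwo-∷ʳ-swap (oneTo-∉ (<-trans (n<1+n k) k<n)) (oneTo-∉ ≤-refl) (>⇒≢ k<n))
... | tri≈ _ refl _ with subst (λ l → 2 ≤ length l) (L-diagonal (suc k)) 2≤len
...   | s≤s ()
L-cyclic n (suc k) 2≤len xs ys last≡ head≡ | tri> _ _ n<k with subst (λ l → 2 ≤ length l) (L-empty n<k) 2≤len
...   | ()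

L-exactlyOnce : ∀ n k ys → IsKSubset n k ys → ExactlyOne (λ xs → SameSet xs ys) (L n k)
L-exactlyOnce zero    zero    []      _             = here SameSet-refl []
L-exactlyOnce (suc n) zero    []      _             = here SameSet-refl []
L-exactlyOnce _       zero    (_ ∷ _) (_ , () , _)
L-exactlyOnce zero    (suc k) ys      s             = ⊥-elim (no-nonempty-subsets-of-∅ s)
L-exactlyOnce (suc n) (suc k) ys      s with suc n ∈? ys
... | no n+1∉ys =
  ExactlyOne-++⁺ˡ (L-exactlyOnce n (suc k) ys (IsKSubset-strengthen n+1∉ys s))
    (All-reverse⁺ (All.map⁺ (All.universal
      (λ xs same → n+1∉ys (Equivalence.to (same (suc n)) (∈-∷ʳ xs))) (L n k))))
... | yes n+1∈ys with ys′ , ys↭ ← ∈⇒↭∷ n+1∈ys =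
  ExactlyOne-++⁺ʳ
    (All.map (λ sx same → IsKSubset-∉ sx (Equivalence.from (same (suc n)) n+1∈ys)) (L-kSubsets n (suc k)))
    (ExactlyOne-reverse⁺ (ExactlyOne-map⁺
      (ExactlyOne-resp (All.map extend (L-kSubsets n k)) (L-exactlyOnce n k ys′ s′))))
  where
  s′ : IsKSubset n k ys′
  s′ = Equivalence.from IsKSubset-∷ (IsKSubset-resp-↭ ys↭ s)
  extend : ∀ {xs} → IsKSubset n k xs → SameSet xs ys′ ⇔ SameSet (xs ∷ʳ suc n) ys
  extend {xs} sx = mk⇔
    (SameSet-resp-↭ (∷↭∷ʳ (suc n) xs) (↭-sym ys↭) ∘ Equivalence.to same-∷)
    (Equivalence.from same-∷ ∘ SameSet-resp-↭ (↭-sym (∷↭∷ʳ (suc n) xs)) ys↭)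
    where
    same-∷ : SameSet xs ys′ ⇔ SameSet (suc n ∷ xs) (suc n ∷ ys′)
    same-∷ = SameSet-∷ (IsKSubset-∉ sx) (IsKSubset-∉ s′)

theorem1 : (K N : ℕ) → 1 ≤ K → 1 ≤ N → (k : ℕ) → 1 ≤ k → k ≤ K →
    All (IsKSubset N k) (L N k)
    × (∀ ys → IsKSubset N k ys → OccursExactlyOnce (L N k) ys)
    × Linked DifferByTwo (L N k)
    × (2 ≤ length (L N k) → ∀ xs ys → last (L N k) ≡ just xs → head (L N k) ≡ just ys →
         DifferByTwo xs ys)
theorem1 _ N _ _ k _ _ =
  L-kSubsets N k ,
  (λ ys s → ExactlyOne⇒lookup (L-exactlyOnce N k ys s)) ,
  L-revolvingDoor N k ,
  L-cyclic N k
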